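{- Let $n\ge1$ be an integer. For $\gamma=(\gamma_1,\dots,\gamma_n)\in\{0,1\}^n$ and $u=(u_1,\dots,u_n)$ write $u^\gamma=u_1^{\gamma_1}\cdots u_n^{\gamma_n}$. Define $S:\{0,1\}^n\to\mathbb{R}$ by the identity of functions on $\{1,-1\}^n$ \[\sum_{d=1}^{n-1}\Big(\sum_{j=1}^n u_ju_{j+d}\Big)^2=\sum_{\gamma\in\{0,1\}^n} S(\gamma)\,u^\gamma\qquad(u\in\{1,-1\}^n),\] i.e. $S(\gamma)$ is the coefficient of the monomial $u^\gamma$ after expanding the left side and reducing with $u_j^2=1$ (indices modulo $n$ in $\{1,\dots,n\}$). Then there exists a vector $u\in\{1,-1\}^n$ generating an $n\times n$ circulant real Hadamard matrix if and only if the homogeneous linear system \[\sum_{\rho\in\{0,1\}^n} M(\gamma+\rho)\,S(\rho)=0\qquad\text{for all }\gamma\in\{0,1\}^n,\] in the real unknowns $M(\gamma)$, $\gamma\in\{0,1\}^n$ (addition in $\{0,1\}^n=\mathbb{Z}_2^n$ is coordinatewise mod $2$), has a solution that is not identically zero.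
   Context: A real Hadamard matrix is a square $\pm1$ matrix with pairwise orthogonal rows. A vector $u=(u_1,\dots,u_n)$ generates the circulant matrix $C$ with $c_{i,j}=u_{j-i+1}$ (index reduced modulo $n$ to $\{1,\dots,n\}$).
   Formalization: The unknowns $M(\gamma)$ of the homogeneous linear system take values in the rationals rather than in the reals. -}

module Defs where

open import Data.Bool using (Bool; true; false; _xor_; if_then_else_)
open import Data.Nat using (ℕ; zero; suc; _∸_; NonZero) renaming (_+_ to _+ℕ_)
open import Data.Nat.DivMod using (_%_; m%n<n)
open import Data.Fin using (Fin; toℕ; fromℕ<; _≟_)
open import Data.List using (List; []; _∷_; _++_; map; foldr; allFin; upTo; concatMap)
open import Data.Vec using (Vec; []; _∷_; zipWith; tabulate)
import Data.Vec.Properties as VecP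
open import Data.Bool.Properties using () renaming (_≟_ to _≟B_)
open import Data.Integer using (ℤ; +_; -_) renaming (_+_ to _+ℤ_; _*_ to _*ℤ_)
open import Data.Rational using (ℚ) renaming (_+_ to _+ℚ_; _*_ to _*ℚ_)
import Data.Rational as ℚ
open import Relation.Nullary using (does)
open import Relation.Binary.PropositionalEquality using (_≡_; _≢_)
open import Data.Sum using (_⊎_)

-- All vectors in {0,1}^n (false = 0, true = 1).
allBV : (n : ℕ) → List (Vec Bool n)
allBV zero = [] ∷ []
allBV (suc n) = map (false ∷_) (allBV n) ++ map (true ∷_) (allBV n)

_⊕_ : {n : ℕ} → Vec Bool n → Vec Bool n → Vec Bool n
_⊕_ = zipWith _xor_
infixl 6 _⊕_

-- Exponent vector of the monomial u_j (0-based index j).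
unitV : {n : ℕ} → Fin n → Vec Bool n
unitV j = tabulate (λ i → does (i ≟ j))

cyc : (n : ℕ) → .{{_ : NonZero n}} → ℕ → Fin n
cyc n k = fromℕ< (m%n<n k n)

-- Expansion of  Σ_{d=1}^{n-1} (Σ_j u_j u_{j+d})^2  =  Σ_{d,j,k} u_j u_{j+d} u_k u_{k+d}:
-- the list of exponent vectors (reduced mod 2, i.e. using u_j^2 = 1) of all terms.
terms : (n : ℕ) → .{{_ : NonZero n}} → List (Vec Bool n)
terms n =
  concatMap (λ d →
    concatMap (λ j →
      map (λ k → unitV j ⊕ unitV (cyc n (toℕ j +ℕ d)) ⊕ unitV k ⊕ unitV (cyc n (toℕ k +ℕ d)))
          (allFin n))
      (allFin n))
    (map suc (upTo (n ∸ 1)))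

count : {n : ℕ} → Vec Bool n → List (Vec Bool n) → ℕ
count γ [] = 0
count γ (t ∷ ts) = (if does (VecP.≡-dec _≟B_ t γ) then 1 else 0) +ℕ count γ ts

S : (n : ℕ) → .{{_ : NonZero n}} → Vec Bool n → ℕ
S n γ = count γ (terms n)

sumℚ : List ℚ → ℚ
sumℚ = foldr _+ℚ_ ℚ.0ℚ

sumℤ : List ℤ → ℤ
sumℤ = foldr _+ℤ_ (+ 0)

IsPM1Vec : {n : ℕ} → (Fin n → ℤ) → Set
IsPM1Vec u = ∀ i → (u i ≡ + 1) ⊎ (u i ≡ - (+ 1))

-- Circulant matrix generated by u: c_{i,j} = u_{j-i+1} (1-based), i.e. u_{(j-i) mod n} (0-based).
circulant : (n : ℕ) → .{{_ : NonZero n}} → (Fin n → ℤ) → Fin n → Fin n → ℤ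
circulant n u i j = u (cyc n ((n +ℕ toℕ j) ∸ toℕ i))

IsHadamard : (n : ℕ) → (Fin n → Fin n → ℤ) → Set
IsHadamard n C =
  (∀ i j → (C i j ≡ + 1) ⊎ (C i j ≡ - (+ 1))) ×'
  (∀ i i' → i ≢ i' → sumℤ (map (λ j → C i j *ℤ C i' j) (allFin n)) ≡ + 0)
  where
  open import Data.Product using () renaming (_×_ to _×'_)

SolvesSystem : (n : ℕ) → .{{_ : NonZero n}} → (Vec Bool n → ℚ) → Set
SolvesSystem n M =
  ∀ γ → sumℚ (map (λ ρ → M (γ ⊕ ρ) *ℚ ((+ S n ρ) ℚ./ 1)) (allBV n)) ≡ ℚ.0ℚ

{-# OPTIONS --safe #-}
module Submission where

-- View {0,1}ⁿ as the group ℤ₂ⁿ, with characters χ_b(γ) = (-1)^(b·γ) and transform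
-- f̂(b) = Σ_σ χ_b(σ) f(σ). The system says M ⋆ S = 0 for the convolution
-- (M ⋆ S)(γ) = Σ_ρ M(γ+ρ) S(ρ), and the transform turns this into M̂(b) Ŝ(b) = 0 for every b.
-- Since S(ρ) counts the monomials u^ρ in Σ_d A_d(u)², where A_d(u) = Σ_j u_j u_{j+d} is the
-- periodic autocorrelation, Ŝ(b) is this polynomial evaluated at u_j = (-1)^(b_j). It vanishes
-- iff every A_d(u) with 0 < d < n vanishes, i.e. iff the rows of the circulant matrix of u are
-- orthogonal. So if some Ŝ(b) = 0, the character χ_b is a nonzero solution; otherwise M̂ = 0,
-- and hence M = 0 because the transform has trivial kernel when 2 is cancellable.

open import Algebra.Bundles using (CommutativeSemiring; CommutativeRing)
open import Data.Bool using (Bool; true; false; not; _∧_; _xor_; if_then_else_)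
open import Data.Bool.Properties using (xor-identityʳ; xor-comm; not-involutive) renaming (_≟_ to _≟ᴮ_)
open import Data.Fin using (Fin; toℕ; fromℕ<) renaming (zero to fzero; suc to fsuc)
import Data.Fin.Properties as Fin
open import Data.Integer using (ℤ; +_; 0ℤ; 1ℤ)
import Data.Integer as ℤ
import Data.Integer.Properties as ℤ
import Data.Integer.Solver as ℤ-Solver
open import Data.List using (List; []; _∷_; _++_; [_]; map; foldr; concatMap; allFin; upTo; applyUpTo; tabulate)
open import Data.List.Membership.Propositional using (_∈_; find; lose)
open import Data.List.Membership.Propositional.Properties
  using (∈-map⁺; ∈-map⁻; ∈-upTo⁺; ∈-upTo⁻; ∈-++⁺ˡ; ∈-++⁺ʳ)
open import Data.List.Properties using (map-∘; map-upTo; map-applyUpTo; map-tabulate; upTo-∷ʳ)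
open import Data.List.Relation.Unary.All using (All; []; _∷_)
import Data.List.Relation.Unary.All as All
open import Data.List.Relation.Unary.Any using (here; any?)
open import Data.Nat using (ℕ; NonZero; _∸_; _<_; _≤_)
import Data.Nat as ℕ
import Data.Nat.Properties as ℕ
open import Data.Nat.DivMod using ([m+n]%n≡m%n; m<n⇒m%n≡m)
open import Data.Product using (Σ; _×_; ∃; _,_; proj₁; proj₂)
open import Data.Rational using (ℚ; 0ℚ; 1ℚ)
import Data.Rational as ℚ
import Data.Rational.Properties as ℚ
import Data.Rational.Solver as ℚ-Solver
import Data.Rational.Unnormalised as ℚᵘ
import Data.Rational.Unnormalised.Properties as ℚᵘ
open import Data.Sum using (_⊎_; inj₁; inj₂; [_,_]′)
open import Data.Vec using (Vec; []; _∷_; lookup) renaming (tabulate to tabulateᵛ)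
open import Data.Vec.Properties using (≡-dec; lookup∘tabulate)
open import Function using (_∘_; id)
open import Function.Bundles using (_⇔_; mk⇔)
open import Relation.Binary.Definitions using (tri<; tri≈; tri>)
open import Relation.Binary.PropositionalEquality as ≡ using (_≡_; _≢_)
open import Relation.Nullary using (does; contradiction; yes; no)
open import Algebra.Properties.CommutativeSemigroup ℕ.+-commutativeSemigroup using (xy∙z≈xz∙y)

open import Defs

tabulate-toℕ : ∀ {a} {A : Set a} m (h : ℕ → A) → tabulate {n = m} (h ∘ toℕ) ≡ applyUpTo h m
tabulate-toℕ ℕ.zero    h = ≡.refl
tabulate-toℕ (ℕ.suc m) h = ≡.cong (h 0 ∷_) (tabulate-toℕ m (h ∘ ℕ.suc))

⊕-cancel : ∀ {n} (ρ σ : Vec Bool n) → (ρ ⊕ σ) ⊕ ρ ≡ σ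
⊕-cancel []      []      = ≡.refl
⊕-cancel (x ∷ ρ) (y ∷ σ) = ≡.cong₂ _∷_ (xor-cancel x y) (⊕-cancel ρ σ)
  where
  xor-cancel : ∀ x y → (x xor y) xor x ≡ y
  xor-cancel false y = xor-identityʳ y
  xor-cancel true  y = ≡.trans (xor-comm (not y) true) (not-involutive y)

∈-allBV : ∀ {n} (b : Vec Bool n) → b ∈ allBV n
∈-allBV []          = here ≡.refl
∈-allBV (false ∷ b) = ∈-++⁺ˡ (∈-map⁺ (false ∷_) (∈-allBV b))
∈-allBV (true ∷ b)  = ∈-++⁺ʳ (map (false ∷_) (allBV _)) (∈-map⁺ (true ∷_) (∈-allBV b))

module Sums {c ℓ} (R : CommutativeSemiring c ℓ) where

  open CommutativeSemiring R
  open import Relation.Binary.Reasoning.Setoid setoid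
  open import Algebra.Properties.CommutativeSemigroup +-commutativeSemigroup using (interchange)

  private variable
    X Y : Set

  ∑ : List X → (X → Carrier) → Carrier
  ∑ xs f = foldr _+_ 0# (map f xs)

  ∑-cong : ∀ {f g : X → Carrier} xs → (∀ x → f x ≈ g x) → ∑ xs f ≈ ∑ xs g
  ∑-cong []       f≈g = refl
  ∑-cong (x ∷ xs) f≈g = +-cong (f≈g x) (∑-cong xs f≈g)

  ∑-++ : ∀ xs ys (f : X → Carrier) → ∑ (xs ++ ys) f ≈ ∑ xs f + ∑ ys f
  ∑-++ []       ys f = sym (+-identityˡ _)
  ∑-++ (x ∷ xs) ys f = trans (+-congˡ (∑-++ xs ys f)) (sym (+-assoc _ _ _))

  ∑-map : ∀ (h : Y → X) xs (f : X → Carrier) → ∑ (map h xs) f ≡ ∑ xs (f ∘ h)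
  ∑-map h xs f = ≡.cong (foldr _+_ 0#) (≡.sym (map-∘ xs))

  ∑-concatMap : ∀ (h : Y → List X) ys (f : X → Carrier) →
                ∑ (concatMap h ys) f ≈ ∑ ys (λ y → ∑ (h y) f)
  ∑-concatMap h []       f = refl
  ∑-concatMap h (y ∷ ys) f = trans (∑-++ (h y) (concatMap h ys) f) (+-congˡ (∑-concatMap h ys f))

  ∑-0# : ∀ (xs : List X) → ∑ xs (λ _ → 0#) ≈ 0#
  ∑-0# []       = refl
  ∑-0# (x ∷ xs) = trans (+-identityˡ _) (∑-0# xs)

  ∑-0#* : ∀ (f : X → Carrier) xs → ∑ xs (λ x → 0# * f x) ≈ 0#
  ∑-0#* f xs = trans (∑-cong xs (λ x → zeroˡ (f x))) (∑-0# xs)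

  ∑-+ : ∀ (f g : X → Carrier) xs → ∑ xs (λ x → f x + g x) ≈ ∑ xs f + ∑ xs g
  ∑-+ f g []       = sym (+-identityˡ 0#)
  ∑-+ f g (x ∷ xs) = trans (+-congˡ (∑-+ f g xs)) (interchange _ _ _ _)

  ∑-*ˡ : ∀ a (f : X → Carrier) xs → ∑ xs (λ x → a * f x) ≈ a * ∑ xs f
  ∑-*ˡ a f []       = sym (zeroʳ a)
  ∑-*ˡ a f (x ∷ xs) = trans (+-congˡ (∑-*ˡ a f xs)) (sym (distribˡ a _ _))

  ∑-*ʳ : ∀ a (f : X → Carrier) xs → ∑ xs (λ x → f x * a) ≈ ∑ xs f * a
  ∑-*ʳ a f []       = sym (zeroˡ a)
  ∑-*ʳ a f (x ∷ xs) = trans (+-congˡ (∑-*ʳ a f xs)) (sym (distribʳ a _ _))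

  ∑-comm : ∀ (h : X → Y → Carrier) xs ys →
           ∑ xs (λ x → ∑ ys (h x)) ≈ ∑ ys (λ y → ∑ xs (λ x → h x y))
  ∑-comm h []       ys = sym (∑-0# ys)
  ∑-comm h (x ∷ xs) ys = trans (+-congˡ (∑-comm h xs ys)) (sym (∑-+ (h x) _ ys))

  ∑-*-∑ : ∀ (f : X → Carrier) (g : Y → Carrier) xs ys →
          ∑ xs (λ x → ∑ ys (λ y → f x * g y)) ≈ ∑ xs f * ∑ ys g
  ∑-*-∑ f g xs ys = trans (∑-cong xs (λ x → ∑-*ˡ (f x) g ys)) (∑-*ʳ (∑ ys g) f xs)

  ∑-allFin : ∀ m (h : ℕ → Carrier) → ∑ (allFin m) (h ∘ toℕ) ≡ ∑ (upTo m) h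
  ∑-allFin m h = ≡.cong (foldr _+_ 0#)
    (≡.trans (map-tabulate {n = m} id (h ∘ toℕ)) (≡.trans (tabulate-toℕ m h) (≡.sym (map-upTo h m))))

  ∑-upTo-suc : ∀ m (h : ℕ → Carrier) → ∑ (upTo (ℕ.suc m)) h ≈ h 0 + ∑ (upTo m) (h ∘ ℕ.suc)
  ∑-upTo-suc m h = +-congˡ (reflexive (≡.cong (foldr _+_ 0#)
    (≡.trans (map-applyUpTo ℕ.suc h m) (≡.sym (map-upTo (h ∘ ℕ.suc) m)))))

  ∑-upTo-∷ʳ : ∀ m (h : ℕ → Carrier) → ∑ (upTo (ℕ.suc m)) h ≈ ∑ (upTo m) h + h m
  ∑-upTo-∷ʳ m h = begin
    ∑ (upTo (ℕ.suc m)) h       ≡⟨ ≡.cong (λ ks → ∑ ks h) (upTo-∷ʳ m) ⟨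
    ∑ (upTo m ++ [ m ]) h      ≈⟨ ∑-++ (upTo m) [ m ] h ⟩
    ∑ (upTo m) h + (h m + 0#)  ≈⟨ +-congˡ (+-identityʳ (h m)) ⟩
    ∑ (upTo m) h + h m         ∎

  ∑-upTo-rotate : ∀ m (h : ℕ → Carrier) → h m ≈ h 0 → ∑ (upTo m) (h ∘ ℕ.suc) ≈ ∑ (upTo m) h
  ∑-upTo-rotate ℕ.zero    h _     = refl
  ∑-upTo-rotate (ℕ.suc m) h hm≈h0 = begin
    ∑ (upTo (ℕ.suc m)) (h ∘ ℕ.suc)        ≈⟨ ∑-upTo-∷ʳ m (h ∘ ℕ.suc) ⟩
    ∑ (upTo m) (h ∘ ℕ.suc) + h (ℕ.suc m)  ≈⟨ +-congˡ hm≈h0 ⟩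
    ∑ (upTo m) (h ∘ ℕ.suc) + h 0          ≈⟨ +-comm _ _ ⟩
    h 0 + ∑ (upTo m) (h ∘ ℕ.suc)          ≈⟨ ∑-upTo-suc m h ⟨
    ∑ (upTo (ℕ.suc m)) h                  ∎

  ∑-upTo-periodic : ∀ m (h : ℕ → Carrier) → (∀ k → h (k ℕ.+ m) ≈ h k) →
                    ∀ c → ∑ (upTo m) (λ j → h (j ℕ.+ c)) ≈ ∑ (upTo m) h
  ∑-upTo-periodic m h periodic ℕ.zero =
    ∑-cong (upTo m) (λ j → reflexive (≡.cong h (ℕ.+-identityʳ j)))
  ∑-upTo-periodic m h periodic (ℕ.suc c) = begin
    ∑ (upTo m) (λ j → h (j ℕ.+ ℕ.suc c))
      ≈⟨ ∑-cong (upTo m) (λ j → reflexive (≡.cong h (ℕ.+-suc j c))) ⟩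
    ∑ (upTo m) (λ j → h (ℕ.suc j ℕ.+ c))
      ≈⟨ ∑-upTo-rotate m (λ j → h (j ℕ.+ c)) h[m+c]≈h[c] ⟩
    ∑ (upTo m) (λ j → h (j ℕ.+ c))
      ≈⟨ ∑-upTo-periodic m h periodic c ⟩
    ∑ (upTo m) h ∎
    where
    h[m+c]≈h[c] : h (m ℕ.+ c) ≈ h c
    h[m+c]≈h[c] = trans (reflexive (≡.cong h (ℕ.+-comm m c))) (periodic c)

  ∑-allBV-suc : ∀ n (f : Vec Bool (ℕ.suc n) → Carrier) →
                ∑ (allBV (ℕ.suc n)) f ≈ ∑ (allBV n) (f ∘ (false ∷_)) + ∑ (allBV n) (f ∘ (true ∷_))
  ∑-allBV-suc n f = begin
    ∑ (map (false ∷_) (allBV n) ++ map (true ∷_) (allBV n)) f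
      ≈⟨ ∑-++ (map (false ∷_) (allBV n)) _ f ⟩
    ∑ (map (false ∷_) (allBV n)) f + ∑ (map (true ∷_) (allBV n)) f
      ≡⟨ ≡.cong₂ _+_ (∑-map (false ∷_) (allBV n) f) (∑-map (true ∷_) (allBV n) f) ⟩
    ∑ (allBV n) (f ∘ (false ∷_)) + ∑ (allBV n) (f ∘ (true ∷_)) ∎

  ∑-allBV-⊕ : ∀ n (γ : Vec Bool n) (f : Vec Bool n → Carrier) →
              ∑ (allBV n) (λ ρ → f (γ ⊕ ρ)) ≈ ∑ (allBV n) f
  ∑-allBV-⊕ ℕ.zero    []          f = refl
  ∑-allBV-⊕ (ℕ.suc n) (false ∷ γ) f = begin
    ∑ (allBV (ℕ.suc n)) (λ ρ → f ((false ∷ γ) ⊕ ρ))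
      ≈⟨ ∑-allBV-suc n _ ⟩
    ∑ (allBV n) (λ ρ → f (false ∷ γ ⊕ ρ)) + ∑ (allBV n) (λ ρ → f (true ∷ γ ⊕ ρ))
      ≈⟨ +-cong (∑-allBV-⊕ n γ (f ∘ (false ∷_))) (∑-allBV-⊕ n γ (f ∘ (true ∷_))) ⟩
    ∑ (allBV n) (f ∘ (false ∷_)) + ∑ (allBV n) (f ∘ (true ∷_))
      ≈⟨ ∑-allBV-suc n f ⟨
    ∑ (allBV (ℕ.suc n)) f ∎
  ∑-allBV-⊕ (ℕ.suc n) (true ∷ γ) f = begin
    ∑ (allBV (ℕ.suc n)) (λ ρ → f ((true ∷ γ) ⊕ ρ))
      ≈⟨ ∑-allBV-suc n _ ⟩
    ∑ (allBV n) (λ ρ → f (true ∷ γ ⊕ ρ)) + ∑ (allBV n) (λ ρ → f (false ∷ γ ⊕ ρ))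
      ≈⟨ +-cong (∑-allBV-⊕ n γ (f ∘ (true ∷_))) (∑-allBV-⊕ n γ (f ∘ (false ∷_))) ⟩
    ∑ (allBV n) (f ∘ (true ∷_)) + ∑ (allBV n) (f ∘ (false ∷_))
      ≈⟨ +-comm _ _ ⟩
    ∑ (allBV n) (f ∘ (false ∷_)) + ∑ (allBV n) (f ∘ (true ∷_))
      ≈⟨ ∑-allBV-suc n f ⟨
    ∑ (allBV (ℕ.suc n)) f ∎

module Characters {c ℓ} (R : CommutativeRing c ℓ) where

  open CommutativeRing R
  open Sums commutativeSemiring public
  open import Relation.Binary.Reasoning.Setoid setoid
  open import Algebra.Properties.CommutativeSemigroup *-commutativeSemigroup
    using () renaming (interchange to *-interchange)
  open import Algebra.Properties.Ring ring using (-1*x≈-x; -‿involutive; x∙y⁻¹≈ε⇒x≈y)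

  sign : Bool → Carrier
  sign false = 1#
  sign true  = - 1#

  χ : ∀ {n} → Vec Bool n → Vec Bool n → Carrier
  χ []      []      = 1#
  χ (a ∷ b) (x ∷ γ) = sign (a ∧ x) * χ b γ

  sign-xor : ∀ a x y → sign (a ∧ (x xor y)) ≈ sign (a ∧ x) * sign (a ∧ y)
  sign-xor false _     _     = sym (*-identityˡ 1#)
  sign-xor true  false y     = sym (*-identityˡ (sign y))
  sign-xor true  true  false = sym (*-identityʳ (- 1#))
  sign-xor true  true  true  = sym (trans (-1*x≈-x (- 1#)) (-‿involutive 1#))

  χ-⊕ : ∀ {n} (b γ σ : Vec Bool n) → χ b (γ ⊕ σ) ≈ χ b γ * χ b σ
  χ-⊕ []      []      []      = sym (*-identityˡ 1#)
  χ-⊕ (a ∷ b) (x ∷ γ) (y ∷ σ) =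
    trans (*-cong (sign-xor a x y) (χ-⊕ b γ σ)) (*-interchange _ _ _ _)

  χ-zero : ∀ {n} (b : Vec Bool n) → χ b (tabulateᵛ (λ _ → false)) ≈ 1#
  χ-zero []          = refl
  χ-zero (false ∷ b) = trans (*-identityˡ _) (χ-zero b)
  χ-zero (true ∷ b)  = trans (*-identityˡ _) (χ-zero b)

  χ-unitV : ∀ {n} (b : Vec Bool n) j → χ b (unitV j) ≈ sign (lookup b j)
  χ-unitV (false ∷ b) fzero    = trans (*-identityˡ _) (χ-zero b)
  χ-unitV (true ∷ b)  fzero    = trans (*-congˡ (χ-zero b)) (*-identityʳ (- 1#))
  χ-unitV (false ∷ b) (fsuc j) = trans (*-identityˡ _) (χ-unitV b j)
  χ-unitV (true ∷ b)  (fsuc j) = trans (*-identityˡ _) (χ-unitV b j)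

  transform : ∀ {n} → (Vec Bool n → Carrier) → Vec Bool n → Carrier
  transform {n} M b = ∑ (allBV n) (λ σ → χ b σ * M σ)

  _⋆_ : ∀ {n} → (Vec Bool n → Carrier) → (Vec Bool n → Carrier) → Vec Bool n → Carrier
  (M ⋆ K) γ = ∑ (allBV _) (λ ρ → M (γ ⊕ ρ) * K ρ)

  χ-⋆ : ∀ {n} (b : Vec Bool n) K γ → (χ b ⋆ K) γ ≈ χ b γ * transform K b
  χ-⋆ {n} b K γ = begin
    ∑ (allBV n) (λ ρ → χ b (γ ⊕ ρ) * K ρ)
      ≈⟨ ∑-cong (allBV n) (λ ρ → trans (*-congʳ (χ-⊕ b γ ρ)) (*-assoc _ _ _)) ⟩
    ∑ (allBV n) (λ ρ → χ b γ * (χ b ρ * K ρ))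
      ≈⟨ ∑-*ˡ (χ b γ) (λ ρ → χ b ρ * K ρ) (allBV n) ⟩
    χ b γ * transform K b ∎

  transform≈0⇒χ⋆≈0 : ∀ {n} (b : Vec Bool n) K → transform K b ≈ 0# → ∀ γ → (χ b ⋆ K) γ ≈ 0#
  transform≈0⇒χ⋆≈0 b K K̂b≈0 γ = trans (χ-⋆ b K γ) (trans (*-congˡ K̂b≈0) (zeroʳ (χ b γ)))

  transform-⋆ : ∀ {n} (M K : Vec Bool n → Carrier) b →
                transform (M ⋆ K) b ≈ transform M b * transform K b
  transform-⋆ {n} M K b = begin
    ∑ V (λ γ → χ b γ * ∑ V (λ ρ → M (γ ⊕ ρ) * K ρ))
      ≈⟨ ∑-cong V (λ γ → sym (∑-*ˡ (χ b γ) (λ ρ → M (γ ⊕ ρ) * K ρ) V)) ⟩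
    ∑ V (λ γ → ∑ V (λ ρ → χ b γ * (M (γ ⊕ ρ) * K ρ)))
      ≈⟨ ∑-comm (λ γ ρ → χ b γ * (M (γ ⊕ ρ) * K ρ)) V V ⟩
    ∑ V (λ ρ → ∑ V (λ γ → χ b γ * (M (γ ⊕ ρ) * K ρ)))
      ≈⟨ ∑-cong V (λ ρ → trans (∑-cong V (λ γ → sym (*-assoc _ _ _)))
                                (∑-*ʳ (K ρ) (λ γ → χ b γ * M (γ ⊕ ρ)) V)) ⟩
    ∑ V (λ ρ → ∑ V (λ γ → χ b γ * M (γ ⊕ ρ)) * K ρ)
      ≈⟨ ∑-cong V (λ ρ → trans (*-congʳ (translate ρ)) (trans (*-congʳ (*-comm _ _)) (*-assoc _ _ _))) ⟩
    ∑ V (λ ρ → transform M b * (χ b ρ * K ρ))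
      ≈⟨ ∑-*ˡ (transform M b) (λ ρ → χ b ρ * K ρ) V ⟩
    transform M b * transform K b ∎
    where
    V = allBV n
    translate : ∀ ρ → ∑ V (λ γ → χ b γ * M (γ ⊕ ρ)) ≈ χ b ρ * transform M b
    translate ρ = begin
      ∑ V (λ γ → χ b γ * M (γ ⊕ ρ))
        ≈⟨ ∑-allBV-⊕ n ρ (λ γ → χ b γ * M (γ ⊕ ρ)) ⟨
      ∑ V (λ σ → χ b (ρ ⊕ σ) * M ((ρ ⊕ σ) ⊕ ρ))
        ≈⟨ ∑-cong V (λ σ → *-cong (χ-⊕ b ρ σ) (reflexive (≡.cong M (⊕-cancel ρ σ)))) ⟩
      ∑ V (λ σ → (χ b ρ * χ b σ) * M σ)
        ≈⟨ ∑-cong V (λ σ → *-assoc _ _ _) ⟩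
      ∑ V (λ σ → χ b ρ * (χ b σ * M σ))
        ≈⟨ ∑-*ˡ (χ b ρ) (λ σ → χ b σ * M σ) V ⟩
      χ b ρ * transform M b ∎

  transform-0# : ∀ {n} (M : Vec Bool n → Carrier) → (∀ γ → M γ ≈ 0#) → ∀ b → transform M b ≈ 0#
  transform-0# {n} M M≈0 b =
    trans (∑-cong (allBV n) (λ γ → trans (*-congˡ (M≈0 γ)) (zeroʳ (χ b γ)))) (∑-0# (allBV n))

  transform-false∷ : ∀ {n} (M : Vec Bool (ℕ.suc n) → Carrier) b →
    transform M (false ∷ b) ≈ transform (M ∘ (false ∷_)) b + transform (M ∘ (true ∷_)) b
  transform-false∷ {n} M b = trans (∑-allBV-suc n _)
    (+-cong (∑-cong (allBV n) (λ σ → *-congʳ (*-identityˡ _)))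
            (∑-cong (allBV n) (λ σ → *-congʳ (*-identityˡ _))))

  transform-true∷ : ∀ {n} (M : Vec Bool (ℕ.suc n) → Carrier) b →
    transform M (true ∷ b) ≈ transform (M ∘ (false ∷_)) b - transform (M ∘ (true ∷_)) b
  transform-true∷ {n} M b = trans (∑-allBV-suc n _)
    (+-cong (∑-cong (allBV n) (λ σ → *-congʳ (*-identityˡ _))) (begin
      ∑ (allBV n) (λ σ → (- 1# * χ b σ) * M (true ∷ σ))
        ≈⟨ ∑-cong (allBV n) (λ σ → *-assoc _ _ _) ⟩
      ∑ (allBV n) (λ σ → - 1# * (χ b σ * M (true ∷ σ)))
        ≈⟨ ∑-*ˡ (- 1#) (λ σ → χ b σ * M (true ∷ σ)) (allBV n) ⟩
      - 1# * transform (M ∘ (true ∷_)) b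
        ≈⟨ -1*x≈-x _ ⟩
      - transform (M ∘ (true ∷_)) b ∎))

  module _ (x+x≈0⇒x≈0 : ∀ x → x + x ≈ 0# → x ≈ 0#) where

    x+y≈0∧x-y≈0⇒x≈0∧y≈0 : ∀ {x y} → x + y ≈ 0# → x - y ≈ 0# → x ≈ 0# × y ≈ 0#
    x+y≈0∧x-y≈0⇒x≈0∧y≈0 {x} {y} x+y≈0 x-y≈0 = trans x≈y y≈0 , y≈0
      where
      x≈y : x ≈ y
      x≈y = x∙y⁻¹≈ε⇒x≈y x y x-y≈0
      y≈0 : y ≈ 0#
      y≈0 = x+x≈0⇒x≈0 y (trans (+-congʳ (sym x≈y)) x+y≈0)

    transform≈0⇒≈0 : ∀ {n} (M : Vec Bool n → Carrier) → (∀ b → transform M b ≈ 0#) → ∀ γ → M γ ≈ 0#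
    transform≈0⇒≈0 M M̂≈0 [] = begin
      M []            ≈⟨ *-identityˡ (M []) ⟨
      1# * M []       ≈⟨ +-identityʳ _ ⟨
      transform M []  ≈⟨ M̂≈0 [] ⟩
      0#              ∎
    transform≈0⇒≈0 M M̂≈0 (x ∷ γ) = restriction≈0 x
      where
      restrictions≈0 : ∀ b → transform (M ∘ (false ∷_)) b ≈ 0# × transform (M ∘ (true ∷_)) b ≈ 0#
      restrictions≈0 b = x+y≈0∧x-y≈0⇒x≈0∧y≈0
        (trans (sym (transform-false∷ M b)) (M̂≈0 (false ∷ b)))
        (trans (sym (transform-true∷ M b)) (M̂≈0 (true ∷ b)))
      restriction≈0 : ∀ x → M (x ∷ γ) ≈ 0#
      restriction≈0 false = transform≈0⇒≈0 (M ∘ (false ∷_)) (proj₁ ∘ restrictions≈0) γ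
      restriction≈0 true  = transform≈0⇒≈0 (M ∘ (true ∷_)) (proj₂ ∘ restrictions≈0) γ

ι : ℤ → ℚ
ι z = z ℚ./ 1

toℚᵘ-ι : ∀ z → ℚ.toℚᵘ (ι z) ℚᵘ.≃ ℚᵘ.mkℚᵘ z 0
toℚᵘ-ι z = ℚ.toℚᵘ-fromℚᵘ (ℚᵘ.mkℚᵘ z 0)

ι-+ : ∀ x y → ι (x ℤ.+ y) ≡ ι x ℚ.+ ι y
ι-+ x y = ℚ.toℚᵘ-injective (begin
  ℚ.toℚᵘ (ι (x ℤ.+ y))             ≈⟨ toℚᵘ-ι (x ℤ.+ y) ⟩
  ℚᵘ.mkℚᵘ (x ℤ.+ y) 0              ≈⟨ ℚᵘ.*≡* cross-multiplied ⟩
  ℚᵘ.mkℚᵘ x 0 ℚᵘ.+ ℚᵘ.mkℚᵘ y 0     ≈⟨ ℚᵘ.+-cong (toℚᵘ-ι x) (toℚᵘ-ι y) ⟨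
  ℚ.toℚᵘ (ι x) ℚᵘ.+ ℚ.toℚᵘ (ι y)   ≈⟨ ℚ.toℚᵘ-homo-+ (ι x) (ι y) ⟨
  ℚ.toℚᵘ (ι x ℚ.+ ι y)             ∎)
  where
  open ℚᵘ.≃-Reasoning
  cross-multiplied : (x ℤ.+ y) ℤ.* 1ℤ ≡ (x ℤ.* 1ℤ ℤ.+ y ℤ.* 1ℤ) ℤ.* 1ℤ
  cross-multiplied = solve 2 (λ x y → (x :+ y) :* con 1ℤ := (x :* con 1ℤ :+ y :* con 1ℤ) :* con 1ℤ) ≡.refl x y
    where open ℤ-Solver.+-*-Solver

ι-* : ∀ x y → ι (x ℤ.* y) ≡ ι x ℚ.* ι y
ι-* x y = ℚ.toℚᵘ-injective (begin
  ℚ.toℚᵘ (ι (x ℤ.* y))             ≈⟨ toℚᵘ-ι (x ℤ.* y) ⟩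
  ℚᵘ.mkℚᵘ x 0 ℚᵘ.* ℚᵘ.mkℚᵘ y 0     ≈⟨ ℚᵘ.*-cong (toℚᵘ-ι x) (toℚᵘ-ι y) ⟨
  ℚ.toℚᵘ (ι x) ℚᵘ.* ℚ.toℚᵘ (ι y)   ≈⟨ ℚ.toℚᵘ-homo-* (ι x) (ι y) ⟨
  ℚ.toℚᵘ (ι x ℚ.* ι y)             ∎)
  where open ℚᵘ.≃-Reasoning

ι≡0⇒≡0 : ∀ {z} → ι z ≡ 0ℚ → z ≡ 0ℤ
ι≡0⇒≡0 {z} ιz≡0 with ℚ.fromℚᵘ-injective {ℚᵘ.mkℚᵘ z 0} {ℚᵘ.mkℚᵘ 0ℤ 0} ιz≡0
... | ℚᵘ.*≡* z*1≡0*1 = ≡.trans (≡.sym (ℤ.*-identityʳ z)) z*1≡0*1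

module ℤχ = Characters ℤ.+-*-commutativeRing
module ℚχ = Characters ℚ.+-*-commutativeRing
module ℕ∑ = Sums ℕ.+-*-commutativeSemiring

open ℤχ using (∑; ∑-cong; ∑-+; ∑-0#*; ∑-map; ∑-concatMap; ∑-*-∑; ∑-allFin; ∑-upTo-periodic;
               ∑-allBV-suc; sign; χ; χ-⊕; χ-unitV)
open ≡.≡-Reasoning

ι-∑ : ∀ {X : Set} (f : X → ℤ) xs → ℚχ.∑ xs (ι ∘ f) ≡ ι (∑ xs f)
ι-∑ f []       = ≡.refl
ι-∑ f (x ∷ xs) = ≡.trans (≡.cong (ι (f x) ℚ.+_) (ι-∑ f xs)) (≡.sym (ι-+ (f x) (∑ xs f)))

ι-χ : ∀ {n} (b γ : Vec Bool n) → ι (χ b γ) ≡ ℚχ.χ b γ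
ι-χ []      []      = ≡.refl
ι-χ (a ∷ b) (x ∷ γ) =
  ≡.trans (ι-* (sign (a ∧ x)) (χ b γ)) (≡.cong₂ ℚ._*_ (ι-sign (a ∧ x)) (ι-χ b γ))
  where
  ι-sign : ∀ c → ι (sign c) ≡ ℚχ.sign c
  ι-sign false = ≡.refl
  ι-sign true  = ≡.refl

x+x≡0⇒x≡0 : ∀ x → x ℚ.+ x ≡ 0ℚ → x ≡ 0ℚ
x+x≡0⇒x≡0 x x+x≡0 = begin
  x                   ≡⟨ solve 1 (λ x → x := con ℚ.½ :* (x :+ x)) ≡.refl x ⟩
  ℚ.½ ℚ.* (x ℚ.+ x)   ≡⟨ ≡.cong (ℚ.½ ℚ.*_) x+x≡0 ⟩
  ℚ.½ ℚ.* 0ℚ          ≡⟨ ℚ.*-zeroʳ ℚ.½ ⟩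
  0ℚ                  ∎
  where open ℚ-Solver.+-*-Solver

xy≡0∧y≢0⇒x≡0 : ∀ {x y} → x ℚ.* y ≡ 0ℚ → y ≢ 0ℚ → x ≡ 0ℚ
xy≡0∧y≢0⇒x≡0 {x} {y} xy≡0 y≢0 = begin
  x                      ≡⟨ ℚ.*-identityʳ x ⟨
  x ℚ.* 1ℚ               ≡⟨ ≡.cong (x ℚ.*_) (ℚ.*-inverseʳ y) ⟨
  x ℚ.* (y ℚ.* ℚ.1/ y)   ≡⟨ ℚ.*-assoc x y (ℚ.1/ y) ⟨
  (x ℚ.* y) ℚ.* ℚ.1/ y   ≡⟨ ≡.cong (ℚ._* ℚ.1/ y) xy≡0 ⟩
  0ℚ ℚ.* ℚ.1/ y          ≡⟨ ℚ.*-zeroˡ (ℚ.1/ y) ⟩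
  0ℚ                     ∎
  where instance _ = ℚ.≢-nonZero y≢0

⋆≡0⇒∃transform≡0 : ∀ {n} (M K : Vec Bool n → ℚ) → (∀ γ → (M ℚχ.⋆ K) γ ≡ 0ℚ) →
                   ∀ {γ} → M γ ≢ 0ℚ → ∃ λ b → ℚχ.transform K b ≡ 0ℚ
⋆≡0⇒∃transform≡0 {n} M K M⋆K≡0 {γ} Mγ≢0
  with any? (λ b → ℚχ.transform K b ℚ.≟ 0ℚ) (allBV n)
... | yes root   = let b , _ , K̂b≡0 = find root in b , K̂b≡0
... | no no-root = contradiction (ℚχ.transform≈0⇒≈0 x+x≡0⇒x≡0 M M̂≡0 γ) Mγ≢0
  where
  M̂≡0 : ∀ b → ℚχ.transform M b ≡ 0ℚ
  M̂≡0 b = xy≡0∧y≢0⇒x≡0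
    (≡.trans (≡.sym (ℚχ.transform-⋆ M K b)) (ℚχ.transform-0# (M ℚχ.⋆ K) M⋆K≡0 b))
    (λ K̂b≡0 → no-root (lose (∈-allBV b) K̂b≡0))

-- δ is the summand of count, so count ρ (t ∷ ts) unfolds to δ t ρ + count ρ ts.
δ : ∀ {n} → Vec Bool n → Vec Bool n → ℕ
δ t ρ = if does (≡-dec _≟ᴮ_ t ρ) then 1 else 0

∑-δ : ∀ n (t : Vec Bool n) (g : Vec Bool n → ℤ) → ∑ (allBV n) (λ ρ → + δ t ρ ℤ.* g ρ) ≡ g t
∑-δ ℕ.zero    []          g = ≡.trans (ℤ.+-identityʳ _) (ℤ.*-identityˡ (g []))
∑-δ (ℕ.suc n) (false ∷ t) g = begin
  ∑ (allBV (ℕ.suc n)) (λ ρ → + δ (false ∷ t) ρ ℤ.* g ρ)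
    ≡⟨ ∑-allBV-suc n _ ⟩
  ∑ (allBV n) (λ ρ → + δ t ρ ℤ.* g (false ∷ ρ)) ℤ.+ ∑ (allBV n) (λ ρ → 0ℤ ℤ.* g (true ∷ ρ))
    ≡⟨ ≡.cong₂ ℤ._+_ (∑-δ n t (g ∘ (false ∷_))) (∑-0#* (g ∘ (true ∷_)) (allBV n)) ⟩
  g (false ∷ t) ℤ.+ 0ℤ
    ≡⟨ ℤ.+-identityʳ _ ⟩
  g (false ∷ t) ∎
∑-δ (ℕ.suc n) (true ∷ t) g = begin
  ∑ (allBV (ℕ.suc n)) (λ ρ → + δ (true ∷ t) ρ ℤ.* g ρ)
    ≡⟨ ∑-allBV-suc n _ ⟩
  ∑ (allBV n) (λ ρ → 0ℤ ℤ.* g (false ∷ ρ)) ℤ.+ ∑ (allBV n) (λ ρ → + δ t ρ ℤ.* g (true ∷ ρ))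
    ≡⟨ ≡.cong₂ ℤ._+_ (∑-0#* (g ∘ (false ∷_)) (allBV n)) (∑-δ n t (g ∘ (true ∷_))) ⟩
  0ℤ ℤ.+ g (true ∷ t)
    ≡⟨ ℤ.+-identityˡ _ ⟩
  g (true ∷ t) ∎

∑-count : ∀ n (ts : List (Vec Bool n)) (g : Vec Bool n → ℤ) →
          ∑ (allBV n) (λ ρ → + count ρ ts ℤ.* g ρ) ≡ ∑ ts g
∑-count n []       g = ∑-0#* g (allBV n)
∑-count n (t ∷ ts) g = begin
  ∑ (allBV n) (λ ρ → + (δ t ρ ℕ.+ count ρ ts) ℤ.* g ρ)
    ≡⟨ ∑-cong (allBV n) (λ ρ → ≡.trans (≡.cong (ℤ._* g ρ) (ℤ.pos-+ (δ t ρ) (count ρ ts)))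
                                        (ℤ.*-distribʳ-+ (g ρ) (+ δ t ρ) (+ count ρ ts))) ⟩
  ∑ (allBV n) (λ ρ → + δ t ρ ℤ.* g ρ ℤ.+ + count ρ ts ℤ.* g ρ)
    ≡⟨ ∑-+ (λ ρ → + δ t ρ ℤ.* g ρ) (λ ρ → + count ρ ts ℤ.* g ρ) (allBV n) ⟩
  ∑ (allBV n) (λ ρ → + δ t ρ ℤ.* g ρ) ℤ.+ ∑ (allBV n) (λ ρ → + count ρ ts ℤ.* g ρ)
    ≡⟨ ≡.cong₂ ℤ._+_ (∑-δ n t g) (∑-count n ts g) ⟩
  g t ℤ.+ ∑ ts g ∎

i*i≡+∣i∣*∣i∣ : ∀ i → i ℤ.* i ≡ + (ℤ.∣ i ∣ ℕ.* ℤ.∣ i ∣)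
i*i≡+∣i∣*∣i∣ (+ m)      = ℤ.+◃n≡+n (m ℕ.* m)
i*i≡+∣i∣*∣i∣ ℤ.-[1+ m ] = ≡.refl

∑-squares : ∀ {X : Set} (f : X → ℤ) xs →
            ∑ xs (λ x → f x ℤ.* f x) ≡ + ℕ∑.∑ xs (λ x → ℤ.∣ f x ∣ ℕ.* ℤ.∣ f x ∣)
∑-squares f []       = ≡.refl
∑-squares f (x ∷ xs) = ≡.trans (≡.cong₂ ℤ._+_ (i*i≡+∣i∣*∣i∣ (f x)) (∑-squares f xs))
                               (≡.sym (ℤ.pos-+ (ℤ.∣ f x ∣ ℕ.* ℤ.∣ f x ∣) _))

∑-squares≡0⇒All≡0 : ∀ {X : Set} (f : X → ℤ) xs →
                    ∑ xs (λ x → f x ℤ.* f x) ≡ 0ℤ → All (λ x → f x ≡ 0ℤ) xs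
∑-squares≡0⇒All≡0 f xs ∑≡0 =
  ∑ℕ≡0⇒All≡0 xs (ℤ.+-injective (≡.trans (≡.sym (∑-squares f xs)) ∑≡0))
  where
  ∑ℕ≡0⇒All≡0 : ∀ xs → ℕ∑.∑ xs (λ x → ℤ.∣ f x ∣ ℕ.* ℤ.∣ f x ∣) ≡ 0 →
               All (λ x → f x ≡ 0ℤ) xs
  ∑ℕ≡0⇒All≡0 []       _  = []
  ∑ℕ≡0⇒All≡0 (x ∷ xs) eq =
    ℤ.∣i∣≡0⇒i≡0 ([ id , id ]′ (ℕ.m*n≡0⇒m≡0∨n≡0 ℤ.∣ f x ∣ (ℕ.m+n≡0⇒m≡0 _ eq)))
    ∷ ∑ℕ≡0⇒All≡0 xs (ℕ.m+n≡0⇒n≡0 _ eq)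

All≡0⇒∑-squares≡0 : ∀ {X : Set} (f : X → ℤ) {xs} →
                    All (λ x → f x ≡ 0ℤ) xs → ∑ xs (λ x → f x ℤ.* f x) ≡ 0ℤ
All≡0⇒∑-squares≡0 f []              = ≡.refl
All≡0⇒∑-squares≡0 f (fx≡0 ∷ fxs≡0) =
  ≡.cong₂ ℤ._+_ (≡.cong (λ z → z ℤ.* z) fx≡0) (All≡0⇒∑-squares≡0 f fxs≡0)

lags : ℕ → List ℕ
lags n = map ℕ.suc (upTo (n ∸ 1))

∈-lags⁺ : ∀ {n d} → 0 < d → d < n → d ∈ lags n
∈-lags⁺ {ℕ.suc n} {ℕ.suc d} _ (ℕ.s≤s d<n) = ∈-map⁺ ℕ.suc (∈-upTo⁺ d<n)

∈-lags⁻ : ∀ {n d} → d ∈ lags n → 0 < d × d < n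
∈-lags⁻ {n} d∈lags with ∈-map⁻ ℕ.suc d∈lags
∈-lags⁻ {ℕ.suc n} _ | k , k∈upTo , ≡.refl = ℕ.z<s , ℕ.s≤s (∈-upTo⁻ k∈upTo)
∈-lags⁻ {ℕ.zero}  _ | k , k∈upTo , ≡.refl with () ← ∈-upTo⁻ {n = 0} k∈upTo

bit : ∀ {x : ℤ} → (x ≡ + 1) ⊎ (x ≡ ℤ.- + 1) → Bool
bit (inj₁ _) = false
bit (inj₂ _) = true

sign-bit : ∀ {x : ℤ} (x≡±1 : (x ≡ + 1) ⊎ (x ≡ ℤ.- + 1)) → sign (bit x≡±1) ≡ x
sign-bit (inj₁ x≡1)  = ≡.sym x≡1
sign-bit (inj₂ x≡-1) = ≡.sym x≡-1

module _ (n : ℕ) .{{_ : NonZero n}} where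

  cyc-+n : ∀ k → cyc n (k ℕ.+ n) ≡ cyc n k
  cyc-+n k = Fin.toℕ-injective
    (≡.trans (Fin.toℕ-fromℕ< _) (≡.trans ([m+n]%n≡m%n k n) (≡.sym (Fin.toℕ-fromℕ< _))))

  cyc-toℕ : ∀ (j : Fin n) → cyc n (toℕ j) ≡ j
  cyc-toℕ j = Fin.toℕ-injective (≡.trans (Fin.toℕ-fromℕ< _) (m<n⇒m%n≡m (Fin.toℕ<n j)))

  autocorrelation : (Fin n → ℤ) → ℕ → ℤ
  autocorrelation w d = ∑ (allFin n) (λ j → w j ℤ.* w (cyc n (toℕ j ℕ.+ d)))

  -- Row i of the circulant matrix is j ↦ W (j + (n ∸ i)) for the n-periodic extension W of w.
  circulant-row-product : ∀ w (i i' : Fin n) → toℕ i' ≤ toℕ i →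
    ∑ (allFin n) (λ j → circulant n w i j ℤ.* circulant n w i' j) ≡ autocorrelation w (toℕ i ∸ toℕ i')
  circulant-row-product w i i' i'≤i = begin
    ∑ (allFin n) (λ j → circulant n w i j ℤ.* circulant n w i' j)
      ≡⟨ ∑-cong (allFin n) (λ j → ≡.cong₂ ℤ._*_ (≡.cong W (shift-i (toℕ j)))
                                                 (≡.cong W (shift-i' (toℕ j)))) ⟩
    ∑ (allFin n) (λ j → g (toℕ j ℕ.+ c))
      ≡⟨ ∑-allFin n (λ k → g (k ℕ.+ c)) ⟩
    ∑ (upTo n) (λ k → g (k ℕ.+ c))
      ≡⟨ ∑-upTo-periodic n g g-periodic c ⟩
    ∑ (upTo n) g
      ≡⟨ ∑-allFin n g ⟨
    ∑ (allFin n) (g ∘ toℕ)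
      ≡⟨ ∑-cong (allFin n) (λ j → ≡.cong (λ x → w x ℤ.* W (toℕ j ℕ.+ d)) (cyc-toℕ j)) ⟩
    autocorrelation w d ∎
    where
    W : ℕ → ℤ
    W = w ∘ cyc n
    a a' c d : ℕ
    a  = toℕ i
    a' = toℕ i'
    c  = n ∸ a
    d  = a ∸ a'
    g : ℕ → ℤ
    g k = W k ℤ.* W (k ℕ.+ d)
    W-periodic : ∀ k → W (k ℕ.+ n) ≡ W k
    W-periodic k = ≡.cong w (cyc-+n k)
    g-periodic : ∀ k → g (k ℕ.+ n) ≡ g k
    g-periodic k = ≡.cong₂ ℤ._*_ (W-periodic k)
      (≡.trans (≡.cong W (xy∙z≈xz∙y k n d)) (W-periodic (k ℕ.+ d)))
    a≤n : a ≤ n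
    a≤n = ℕ.<⇒≤ (Fin.toℕ<n i)
    shift-i : ∀ k → (n ℕ.+ k) ∸ a ≡ k ℕ.+ c
    shift-i k = ≡.trans (≡.cong (_∸ a) (ℕ.+-comm n k)) (ℕ.+-∸-assoc k a≤n)
    shift-i' : ∀ k → (n ℕ.+ k) ∸ a' ≡ (k ℕ.+ c) ℕ.+ d
    shift-i' k = begin
      (n ℕ.+ k) ∸ a'                ≡⟨ ≡.cong (_∸ a') (ℕ.+-comm n k) ⟩
      (k ℕ.+ n) ∸ a'                ≡⟨ ℕ.+-∸-assoc k (ℕ.≤-trans i'≤i a≤n) ⟩
      k ℕ.+ (n ∸ a')                ≡⟨ ≡.cong (λ m → k ℕ.+ (m ∸ a')) (ℕ.m∸n+n≡m a≤n) ⟨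
      k ℕ.+ ((c ℕ.+ a) ∸ a')        ≡⟨ ≡.cong (k ℕ.+_) (ℕ.+-∸-assoc c i'≤i) ⟩
      k ℕ.+ (c ℕ.+ d)               ≡⟨ ℕ.+-assoc k c d ⟨
      (k ℕ.+ c) ℕ.+ d               ∎

  autocorrelation≡0⇒rows-orthogonal : ∀ w → All (λ d → autocorrelation w d ≡ 0ℤ) (lags n) →
    ∀ (i i' : Fin n) → toℕ i' < toℕ i →
    ∑ (allFin n) (λ j → circulant n w i j ℤ.* circulant n w i' j) ≡ 0ℤ
  autocorrelation≡0⇒rows-orthogonal w A≡0 i i' i'<i =
    ≡.trans (circulant-row-product w i i' (ℕ.<⇒≤ i'<i)) (All.lookup A≡0 i∸i'∈lags)
    where
    i∸i'∈lags : toℕ i ∸ toℕ i' ∈ lags n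
    i∸i'∈lags = ∈-lags⁺ (ℕ.m<n⇒0<n∸m i'<i) (ℕ.≤-<-trans (ℕ.m∸n≤m (toℕ i) (toℕ i')) (Fin.toℕ<n i))

  autocorrelation≡0⇒hadamard : ∀ w → IsPM1Vec w → All (λ d → autocorrelation w d ≡ 0ℤ) (lags n) →
                               IsHadamard n (circulant n w)
  autocorrelation≡0⇒hadamard w w±1 A≡0 = (λ i j → w±1 _) , orthogonal
    where
    orthogonal : ∀ i i' → i ≢ i' → ∑ (allFin n) (λ j → circulant n w i j ℤ.* circulant n w i' j) ≡ 0ℤ
    orthogonal i i' i≢i' with ℕ.<-cmp (toℕ i) (toℕ i')
    ... | tri< i<i' _ _ = ≡.trans (∑-cong (allFin n) (λ j → ℤ.*-comm (circulant n w i j) (circulant n w i' j)))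
                                  (autocorrelation≡0⇒rows-orthogonal w A≡0 i' i i<i')
    ... | tri≈ _ i≡i' _ = contradiction (Fin.toℕ-injective i≡i') i≢i'
    ... | tri> _ _ i'<i = autocorrelation≡0⇒rows-orthogonal w A≡0 i i' i'<i

  hadamard⇒autocorrelation≡0 : ∀ w → IsHadamard n (circulant n w) →
                               All (λ d → autocorrelation w d ≡ 0ℤ) (lags n)
  hadamard⇒autocorrelation≡0 w (_ , orthogonal) = All.tabulate (λ d∈lags → lag (∈-lags⁻ d∈lags))
    where
    lag : ∀ {d} → 0 < d × d < n → autocorrelation w d ≡ 0ℤ
    lag {d} (0<d , d<n) = begin
      autocorrelation w d
        ≡⟨ ≡.cong (autocorrelation w) (≡.cong₂ _∸_ toℕ-i toℕ-i₀) ⟨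
      autocorrelation w (toℕ i ∸ toℕ i₀)
        ≡⟨ circulant-row-product w i i₀ (≡.subst (_≤ toℕ i) (≡.sym toℕ-i₀) ℕ.z≤n) ⟨
      ∑ (allFin n) (λ j → circulant n w i j ℤ.* circulant n w i₀ j)
        ≡⟨ orthogonal i i₀ i≢i₀ ⟩
      0ℤ ∎
      where
      0<n = ℕ.<-trans 0<d d<n
      i i₀ : Fin n
      i  = fromℕ< d<n
      i₀ = fromℕ< 0<n
      toℕ-i : toℕ i ≡ d
      toℕ-i = Fin.toℕ-fromℕ< d<n
      toℕ-i₀ : toℕ i₀ ≡ 0
      toℕ-i₀ = Fin.toℕ-fromℕ< 0<n
      i≢i₀ : i ≢ i₀
      i≢i₀ i≡i₀ = ℕ.<⇒≢ 0<d (≡.trans (≡.sym toℕ-i₀) (≡.trans (≡.cong toℕ (≡.sym i≡i₀)) toℕ-i))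

  ∑autocorrelation² : (Fin n → ℤ) → ℤ
  ∑autocorrelation² w = ∑ (lags n) (λ d → autocorrelation w d ℤ.* autocorrelation w d)

  ∑autocorrelation²-cong : ∀ {v w} → (∀ j → v j ≡ w j) →
                           ∑autocorrelation² v ≡ ∑autocorrelation² w
  ∑autocorrelation²-cong {v} {w} v≗w = ∑-cong (lags n) (λ d → ≡.cong₂ ℤ._*_ (A-cong d) (A-cong d))
    where
    A-cong : ∀ d → autocorrelation v d ≡ autocorrelation w d
    A-cong d = ∑-cong (allFin n) (λ j → ≡.cong₂ ℤ._*_ (v≗w j) (v≗w (cyc n (toℕ j ℕ.+ d))))

  hadamard⇒∑autocorrelation²≡0 : ∀ w → IsHadamard n (circulant n w) → ∑autocorrelation² w ≡ 0ℤ
  hadamard⇒∑autocorrelation²≡0 w hadamard =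
    All≡0⇒∑-squares≡0 (autocorrelation w) (hadamard⇒autocorrelation≡0 w hadamard)

  ∑autocorrelation²≡0⇒hadamard : ∀ w → IsPM1Vec w → ∑autocorrelation² w ≡ 0ℤ →
                                 IsHadamard n (circulant n w)
  ∑autocorrelation²≡0⇒hadamard w w±1 ∑A²≡0 =
    autocorrelation≡0⇒hadamard w w±1 (∑-squares≡0⇒All≡0 (autocorrelation w) (lags n) ∑A²≡0)

  signs : Vec Bool n → Fin n → ℤ
  signs b j = sign (lookup b j)

  signs-±1 : ∀ b → IsPM1Vec (signs b)
  signs-±1 b j with lookup b j
  ... | false = inj₁ ≡.refl
  ... | true  = inj₂ ≡.refl

  bits : ∀ {u} → IsPM1Vec u → Vec Bool n
  bits u±1 = tabulateᵛ (λ j → bit (u±1 j))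

  signs-bits : ∀ {u} (u±1 : IsPM1Vec u) j → signs (bits u±1) j ≡ u j
  signs-bits u±1 j = ≡.trans (≡.cong sign (lookup∘tabulate _ j)) (sign-bit (u±1 j))

  -- Pairing the term counts S with χ b evaluates the expansion of Σ_d A_d(u)² at u = signs b.
  transform-S : ∀ b → ℤχ.transform (λ ρ → + S n ρ) b ≡ ∑autocorrelation² (signs b)
  transform-S b = begin
    ∑ (allBV n) (λ ρ → χ b ρ ℤ.* + S n ρ)
      ≡⟨ ∑-cong (allBV n) (λ ρ → ℤ.*-comm (χ b ρ) (+ S n ρ)) ⟩
    ∑ (allBV n) (λ ρ → + S n ρ ℤ.* χ b ρ)
      ≡⟨ ∑-count n (terms n) (χ b) ⟩
    ∑ (terms n) (χ b)
      ≡⟨ ∑-concatMap (λ d → concatMap (λ j → map (term d j) (allFin n)) (allFin n)) (lags n) (χ b) ⟩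
    ∑ (lags n) (λ d → ∑ (concatMap (λ j → map (term d j) (allFin n)) (allFin n)) (χ b))
      ≡⟨ ∑-cong (lags n) (λ d → ≡.trans (∑-concatMap (λ j → map (term d j) (allFin n)) (allFin n) (χ b))
                                         (∑-cong (allFin n) (λ j → ∑-map (term d j) (allFin n) (χ b)))) ⟩
    ∑ (lags n) (λ d → ∑ (allFin n) (λ j → ∑ (allFin n) (λ k → χ b (term d j k))))
      ≡⟨ ∑-cong (lags n) (λ d → ∑-cong (allFin n) (λ j → ∑-cong (allFin n) (χ-term d j))) ⟩
    ∑ (lags n) (λ d → ∑ (allFin n) (λ j → ∑ (allFin n) (λ k → p d j ℤ.* p d k)))
      ≡⟨ ∑-cong (lags n) (λ d → ∑-*-∑ (p d) (p d) (allFin n) (allFin n)) ⟩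
    ∑autocorrelation² (signs b) ∎
    where
    u = signs b
    p : ℕ → Fin n → ℤ
    p d j = u j ℤ.* u (cyc n (toℕ j ℕ.+ d))
    term : ℕ → Fin n → Fin n → Vec Bool n
    term d j k = unitV j ⊕ unitV (cyc n (toℕ j ℕ.+ d)) ⊕ unitV k ⊕ unitV (cyc n (toℕ k ℕ.+ d))
    χ-term : ∀ d j k → χ b (term d j k) ≡ p d j ℤ.* p d k
    χ-term d j k = begin
      χ b (((e j ⊕ e j') ⊕ e k) ⊕ e k')
        ≡⟨ χ-⊕ b ((e j ⊕ e j') ⊕ e k) (e k') ⟩
      χ b ((e j ⊕ e j') ⊕ e k) ℤ.* χ b (e k')
        ≡⟨ ≡.cong (ℤ._* χ b (e k')) (χ-⊕ b (e j ⊕ e j') (e k)) ⟩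
      χ b (e j ⊕ e j') ℤ.* χ b (e k) ℤ.* χ b (e k')
        ≡⟨ ≡.cong (λ x → x ℤ.* χ b (e k) ℤ.* χ b (e k')) (χ-⊕ b (e j) (e j')) ⟩
      χ b (e j) ℤ.* χ b (e j') ℤ.* χ b (e k) ℤ.* χ b (e k')
        ≡⟨ ≡.cong₂ ℤ._*_ (≡.cong₂ ℤ._*_ (≡.cong₂ ℤ._*_ (χ-unitV b j) (χ-unitV b j')) (χ-unitV b k))
                         (χ-unitV b k') ⟩
      u j ℤ.* u j' ℤ.* u k ℤ.* u k'
        ≡⟨ ℤ.*-assoc (u j ℤ.* u j') (u k) (u k') ⟩
      p d j ℤ.* p d k ∎
      where
      e = unitV {n}
      j' = cyc n (toℕ j ℕ.+ d)
      k' = cyc n (toℕ k ℕ.+ d)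

  Sℚ : Vec Bool n → ℚ
  Sℚ ρ = ι (+ S n ρ)

  transform-Sℚ : ∀ b → ℚχ.transform Sℚ b ≡ ι (∑autocorrelation² (signs b))
  transform-Sℚ b = begin
    ℚχ.∑ (allBV n) (λ ρ → ℚχ.χ b ρ ℚ.* ι (+ S n ρ))
      ≡⟨ ℚχ.∑-cong (allBV n) (λ ρ → ≡.trans (ι-* (χ b ρ) (+ S n ρ))
                                             (≡.cong (ℚ._* ι (+ S n ρ)) (ι-χ b ρ))) ⟨
    ℚχ.∑ (allBV n) (λ ρ → ι (χ b ρ ℤ.* + S n ρ))
      ≡⟨ ι-∑ (λ ρ → χ b ρ ℤ.* + S n ρ) (allBV n) ⟩
    ι (ℤχ.transform (λ ρ → + S n ρ) b)
      ≡⟨ ≡.cong ι (transform-S b) ⟩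
    ι (∑autocorrelation² (signs b)) ∎

  hadamard⇒transform-Sℚ[bits]≡0 : ∀ {u} (u±1 : IsPM1Vec u) → IsHadamard n (circulant n u) →
                                  ℚχ.transform Sℚ (bits u±1) ≡ 0ℚ
  hadamard⇒transform-Sℚ[bits]≡0 {u} u±1 hadamard = begin
    ℚχ.transform Sℚ (bits u±1)               ≡⟨ transform-Sℚ (bits u±1) ⟩
    ι (∑autocorrelation² (signs (bits u±1)))  ≡⟨ ≡.cong ι (∑autocorrelation²-cong (signs-bits u±1)) ⟩
    ι (∑autocorrelation² u)                   ≡⟨ ≡.cong ι (hadamard⇒∑autocorrelation²≡0 u hadamard) ⟩
    0ℚ                                        ∎

  transform-Sℚ≡0⇒hadamard : ∀ b → ℚχ.transform Sℚ b ≡ 0ℚ → IsHadamard n (circulant n (signs b))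
  transform-Sℚ≡0⇒hadamard b Ŝb≡0 = ∑autocorrelation²≡0⇒hadamard (signs b) (signs-±1 b)
    (ι≡0⇒≡0 (≡.trans (≡.sym (transform-Sℚ b)) Ŝb≡0))

lemma2 : (n : ℕ) → .{{_ : NonZero n}} →
    (Σ (Fin n → ℤ) (λ u → IsPM1Vec u × IsHadamard n (circulant n u)))
    ⇔
    (Σ (Vec Bool n → ℚ) (λ M → SolvesSystem n M × ∃ (λ γ → M γ ≢ 0ℚ)))
lemma2 n = mk⇔
  (λ (u , u±1 , hadamard) → let b = bits n u±1 in
    ℚχ.χ b ,
    ℚχ.transform≈0⇒χ⋆≈0 b (Sℚ n) (hadamard⇒transform-Sℚ[bits]≡0 n u±1 hadamard) ,
    tabulateᵛ (λ _ → false) ,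
    λ χb0≡0 → contradiction (≡.trans (≡.sym (ℚχ.χ-zero b)) χb0≡0) λ ())
  (λ (M , solves , γ , Mγ≢0) → let b , Ŝb≡0 = ⋆≡0⇒∃transform≡0 M (Sℚ n) solves Mγ≢0 in
    signs n b , signs-±1 n b , transform-Sℚ≡0⇒hadamard n b Ŝb≡0)
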